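{- Let $C$ be a Boolean circuit with input variables $x_1,\dots,x_n$ and gates $\neg$, $\wedge$, $\vee$ (fan-in at most 2), and let $r_1(C)$ be the CNF defined in the context. Over any ring $R$, there is an $\mathrm{IPS}_R$ derivation of $1-\mathrm{alg}(C)$ from $1-\mathrm{alg}(r_1(C))$ and the Boolean axioms (for all variables of $r_1(C)$), of size $O(\mathrm{gates}(C))$.
   Context: The CNF $r_1(C)$: introduce a new Boolean variable $x_g$ for each gate $g$ of $C$ (for an input gate use the input variable). For $g=\neg h$ add clauses $(x_g\vee x_h)\wedge(\neg x_g\vee\neg x_h)$; for $g=h\wedge k$ add $(\neg x_g\vee x_h)\wedge(\neg x_g\vee x_k)\wedge(x_g\vee\neg x_h\vee\neg x_k)$; for $g=h\vee k$ add $(\neg x_g\vee x_h\vee x_k)\wedge(x_g\vee\neg x_h)\wedge(x_g\vee\neg x_k)$; for the output gate $g$ add the clause $(x_g)$. The algebraic translation: $\mathrm{alg}(x)=x$, $\mathrm{alg}(\neg\psi)=1-\mathrm{alg}(\psi)$, $\mathrm{alg}(\psi\wedge\chi)=\mathrm{alg}(\psi)\mathrm{alg}(\chi)$, $\mathrm{alg}(\psi\vee\chi)=1-(1-\mathrm{alg}(\psi))(1-\mathrm{alg}(\chi))$, applied to the Boolean function computed by $C$ gate by gate (so $\mathrm{alg}(C)$ is given by an algebraic circuit). Boolean axioms: $v^2-v$ for each variable $v$. An $\mathrm{IPS}_R$ derivation of $G$ from $F_1,\dots,F_r$ is an algebraic circuit over $R$ computing $P(\overline{x},\overline{y})$ with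 $P(\overline{x},F_1,\dots,F_r)=G$ and $P(\overline{x},\overline{0})=0$. $\mathrm{gates}(C)$ is the number of gates of $C$. -}

module Defs where

open import Level using (Level; _⊔_; Setω) renaming (suc to lsuc)
open import Data.Nat using (ℕ; zero; suc; _*_; _≤_)
open import Data.Fin using (Fin; zero; suc; inject₁)
open import Data.Vec using (Vec; tabulate; lookup; _∷ʳ_)
open import Data.List using (List; []; _∷_; _++_; [_])
open import Data.Sum using (_⊎_; inj₁; inj₂)
open import Algebra.Bundles using (CommutativeRing)

-- Nodes are numbered 0,1,2,...; nodes 0..n-1 are the input gates x_1..x_n,
-- every further node is a gate whose arguments are earlier nodes.

data Gate (k : ℕ) : Set where
  notG : Fin k → Gate k
  andG : Fin k → Fin k → Gate k
  orG  : Fin k → Fin k → Gate k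

-- Gates n k : a circuit body with n inputs and k nodes in total
-- (input gates included).
data Gates (n : ℕ) : ℕ → Set where
  inputs : Gates n n
  _▷_    : ∀ {k} → Gates n k → Gate k → Gates n (suc k)

record BoolCircuit (n k : ℕ) : Set where
  constructor circuit
  field
    body   : Gates n k
    output : Fin k
open BoolCircuit public

gates : ∀ {n k} → BoolCircuit n k → ℕ
gates {k = k} _ = k

inputNode : ∀ {n k} → Gates n k → Fin n → Fin k
inputNode inputs     i = i
inputNode (gs ▷ _)   i = inject₁ (inputNode gs i)

-- CNFs and r_1(C).  Variables of r_1(C) are the nodes (Fin k):
-- x_g for gate g, and for an input gate the input variable itself.

data Literal (V : Set) : Set where
  pos : V → Literal V
  neg : V → Literal V

Clause : Set → Set
Clause V = List (Literal V)

CNF : Set → Set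
CNF V = List (Clause V)

gateClauses : ∀ {k} → Gate k → CNF (Fin (suc k))
gateClauses {k} (notG h) =
  let g = Data.Fin.fromℕ k ; h′ = inject₁ h in
  (pos g ∷ pos h′ ∷ []) ∷ (neg g ∷ neg h′ ∷ []) ∷ []
gateClauses {k} (andG h k′) =
  let g = Data.Fin.fromℕ k ; a = inject₁ h ; b = inject₁ k′ in
  (neg g ∷ pos a ∷ []) ∷ (neg g ∷ pos b ∷ []) ∷ (pos g ∷ neg a ∷ neg b ∷ []) ∷ []
gateClauses {k} (orG h k′) =
  let g = Data.Fin.fromℕ k ; a = inject₁ h ; b = inject₁ k′ in
  (neg g ∷ pos a ∷ pos b ∷ []) ∷ (pos g ∷ neg a ∷ []) ∷ (pos g ∷ neg b ∷ []) ∷ []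

mapLit : ∀ {V W} → (V → W) → Literal V → Literal W
mapLit f (pos v) = pos (f v)
mapLit f (neg v) = neg (f v)

mapCNF : ∀ {V W} → (V → W) → CNF V → CNF W
mapCNF f = Data.List.map (Data.List.map (mapLit f))

bodyClauses : ∀ {n k} → Gates n k → CNF (Fin k)
bodyClauses inputs   = []
bodyClauses (gs ▷ g) = mapCNF inject₁ (bodyClauses gs) ++ gateClauses g

r₁ : ∀ {n k} → BoolCircuit n k → CNF (Fin k)
r₁ C = bodyClauses (body C) ++ [ pos (output C) ∷ [] ]

-- Polynomials over a commutative ring R in variables V: terms modulo the
-- congruence generated by the commutative-ring laws and the laws making
-- constants a ring homomorphism from R.  This quotient is exactly R[V], so
-- _≋_ is equality of polynomials (polynomial identity).

module _ {a ℓ : Level} (R : CommutativeRing a ℓ) where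
  private module R = CommutativeRing R

  data Term (V : Set) : Set a where
    var : V → Term V
    con : R.Carrier → Term V
    _⊕_ : Term V → Term V → Term V
    _⊗_ : Term V → Term V → Term V

  infixl 6 _⊕_
  infixl 7 _⊗_
  infix 4 _≋_

  data _≋_ {V : Set} : Term V → Term V → Set (a ⊔ ℓ) where
    ≋-refl  : ∀ {p} → p ≋ p
    ≋-sym   : ∀ {p q} → p ≋ q → q ≋ p
    ≋-trans : ∀ {p q r} → p ≋ q → q ≋ r → p ≋ r
    ⊕-cong  : ∀ {p p′ q q′} → p ≋ p′ → q ≋ q′ → p ⊕ q ≋ p′ ⊕ q′
    ⊗-cong  : ∀ {p p′ q q′} → p ≋ p′ → q ≋ q′ → p ⊗ q ≋ p′ ⊗ q′
    ⊕-assoc : ∀ p q r → (p ⊕ q) ⊕ r ≋ p ⊕ (q ⊕ r)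
    ⊕-comm  : ∀ p q → p ⊕ q ≋ q ⊕ p
    ⊕-idˡ   : ∀ p → con R.0# ⊕ p ≋ p
    ⊕-invˡ  : ∀ p → (con (R.- R.1#) ⊗ p) ⊕ p ≋ con R.0#
    ⊗-assoc : ∀ p q r → (p ⊗ q) ⊗ r ≋ p ⊗ (q ⊗ r)
    ⊗-comm  : ∀ p q → p ⊗ q ≋ q ⊗ p
    ⊗-idˡ   : ∀ p → con R.1# ⊗ p ≋ p
    distribˡ : ∀ p q r → p ⊗ (q ⊕ r) ≋ (p ⊗ q) ⊕ (p ⊗ r)
    con-cong : ∀ {x y} → x R.≈ y → con x ≋ con y
    con-+   : ∀ x y → con (x R.+ y) ≋ con x ⊕ con y
    con-*   : ∀ x y → con (x R.* y) ≋ con x ⊗ con y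

  one : ∀ {V} → Term V
  one = con R.1#

  _⊖_ : ∀ {V} → Term V → Term V → Term V
  p ⊖ q = p ⊕ (con (R.- R.1#) ⊗ q)

  rename : ∀ {V W} → (V → W) → Term V → Term W
  rename f (var v) = var (f v)
  rename f (con r) = con r
  rename f (p ⊕ q) = rename f p ⊕ rename f q
  rename f (p ⊗ q) = rename f p ⊗ rename f q

  subst : ∀ {V W} → (V → Term W) → Term V → Term W
  subst σ (var v) = σ v
  subst σ (con r) = con r
  subst σ (p ⊕ q) = subst σ p ⊕ subst σ q
  subst σ (p ⊗ q) = subst σ p ⊗ subst σ q

  data AGate (V : Set) (s : ℕ) : Set a where
    aVar : V → AGate V s
    aCon : R.Carrier → AGate V s
    aAdd : Fin s → Fin s → AGate V s
    aMul : Fin s → Fin s → AGate V s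

  data AGates (V : Set) : ℕ → Set a where
    []  : AGates V 0
    _▷_ : ∀ {s} → AGates V s → AGate V s → AGates V (suc s)

  record AlgCircuit (V : Set) : Set a where
    constructor algCircuit
    field
      size   : ℕ
      agates : AGates V size
      out    : Fin size

  agateVal : ∀ {V s} → Vec (Term V) s → AGate V s → Term V
  agateVal vs (aVar v)   = var v
  agateVal vs (aCon r)   = con r
  agateVal vs (aAdd i j) = lookup vs i ⊕ lookup vs j
  agateVal vs (aMul i j) = lookup vs i ⊗ lookup vs j

  agatesVals : ∀ {V s} → AGates V s → Vec (Term V) s
  agatesVals []       = Data.Vec.[]
  agatesVals (gs ▷ g) = let vs = agatesVals gs in vs ∷ʳ agateVal vs g

  computes : ∀ {V} → AlgCircuit V → Term V
  computes C = lookup (agatesVals (AlgCircuit.agates C)) (AlgCircuit.out C)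

  -- IPS_R derivations of G from F_1..F_r (variables x̄ : V, placeholders ȳ : Fin r)

  record IPS {V : Set} {r : ℕ} (F : Fin r → Term V) (G : Term V) : Set (a ⊔ ℓ) where
    field
      proof   : AlgCircuit (V ⊎ Fin r)
      sound   : subst (λ { (inj₁ v) → var v ; (inj₂ j) → F j }) (computes proof) ≋ G
      vanish  : subst (λ { (inj₁ v) → var v ; (inj₂ j) → con R.0# }) (computes proof) ≋ con R.0#

  ipsSize : ∀ {V r} {F : Fin r → Term V} {G} → IPS F G → ℕ
  ipsSize d = AlgCircuit.size (IPS.proof d)

  algLit : ∀ {V} → Literal V → Term V
  algLit (pos v) = var v
  algLit (neg v) = one ⊖ var v

  prodNeg : ∀ {V} → Clause V → Term V
  prodNeg []       = one
  prodNeg (l ∷ ls) = (one ⊖ algLit l) ⊗ prodNeg ls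

  algClause : ∀ {V} → Clause V → Term V
  algClause c = one ⊖ prodNeg c

  algCNF : ∀ {V} → CNF V → Term V
  algCNF []       = one
  algCNF (c ∷ cs) = algClause c ⊗ algCNF cs

  algGate : ∀ {n k} → Vec (Term (Fin n)) k → Gate k → Term (Fin n)
  algGate vs (notG h)   = one ⊖ lookup vs h
  algGate vs (andG h k) = lookup vs h ⊗ lookup vs k
  algGate vs (orG h k)  = one ⊖ ((one ⊖ lookup vs h) ⊗ (one ⊖ lookup vs k))

  algNodes : ∀ {n k} → Gates n k → Vec (Term (Fin n)) k
  algNodes inputs   = tabulate var
  algNodes (gs ▷ g) = let vs = algNodes gs in vs ∷ʳ algGate vs g

  algC : ∀ {n k} → BoolCircuit n k → Term (Fin n)
  algC C = lookup (algNodes (body C)) (output C)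

  hyps : ∀ {n k} → BoolCircuit n k → Fin (suc k) → Term (Fin k)
  hyps C zero    = one ⊖ algCNF (r₁ C)
  hyps C (suc v) = (var v ⊗ var v) ⊖ var v

  target : ∀ {n k} → BoolCircuit n k → Term (Fin k)
  target C = one ⊖ rename (inputNode (body C)) (algC C)

record ∃Const (P : ℕ → Setω) : Setω where
  constructor _,_
  field
    const : ℕ
    holds : P const

{-# OPTIONS --safe #-}
module Submission where

-- Let F be the product of alg(c) over the clauses c of r₁(C). For a clause c the polynomial
-- p = 1 − alg(c) = ∏ₗ (1 − alg(l)) is idempotent modulo the Boolean axioms, so a derivation of
-- 1 − (1 − p)·S yields derivations of p and of 1 − S; peeling the clauses off 1 − F one at a
-- time therefore derives 1 − alg(c) for every clause c. With T_v the polynomial computed by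
-- alg(C) at node v, the clauses of a gate g with arguments h, h′ turn derivations of x_h − T_h
-- and x_h′ − T_h′ into one of x_g − T_g, and the unit clause (x_out) turns x_out − T_out into
-- 1 − alg(C). The partial products of F and the polynomials T_v are shared nodes of the
-- certificate, and each gate has at most three clauses of width at most three, so every gate
-- costs a bounded number of certificate gates.

open import Level using (_⊔_)
open import Defs
open import Algebra.Bundles using (CommutativeRing)
open import Algebra.Structures using (IsCommutativeRing)
open import Algebra.Solver.Ring.AlmostCommutativeRing using (fromCommutativeRing; _-Raw-AlmostCommutative⟶_)
open import Data.Fin using (Fin; zero; suc; inject₁; fromℕ)
open import Data.Integer as ℤ using (ℤ; +_; -[1+_]; sign; ∣_∣; _◃_)
import Data.Integer.Properties as ℤ
open import Data.List using ([]; _∷_; _++_)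
import Data.List.Properties as List
open import Data.List.Relation.Unary.All using (All; []; _∷_)
open import Data.Maybe using (Maybe; just; nothing)
open import Data.Nat as ℕ using (ℕ; zero; suc; _≤_)
import Data.Nat.Properties as ℕ
open import Data.Nat.Tactic.RingSolver using (solve-∀)
open import Data.Product using (Σ; _×_; _,_; map₂)
open import Data.Sign as Sign using (Sign)
open import Data.Sum using (_⊎_; inj₁; inj₂)
open import Data.Unit using (tt)
open import Data.Vec as Vec using (Vec; lookup; _∷ʳ_)
import Data.Vec.Properties as Vec
open import Function using (_∘_)
open import Relation.Binary.PropositionalEquality as ≡ using (_≡_; _≗_)
open import Relation.Nullary using (yes; no)

lookup-∷ʳ-inject₁ : ∀ {a} {A : Set a} {n} (xs : Vec A n) x i → lookup (xs ∷ʳ x) (inject₁ i) ≡ lookup xs i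
lookup-∷ʳ-inject₁ (y Vec.∷ xs) x zero    = ≡.refl
lookup-∷ʳ-inject₁ (y Vec.∷ xs) x (suc i) = lookup-∷ʳ-inject₁ xs x i

lookup-∷ʳ-fromℕ : ∀ {a} {A : Set a} {n} (xs : Vec A n) x → lookup (xs ∷ʳ x) (fromℕ n) ≡ x
lookup-∷ʳ-fromℕ Vec.[]       x = ≡.refl
lookup-∷ʳ-fromℕ (y Vec.∷ xs) x = lookup-∷ʳ-fromℕ xs x

inject₁-fromℕ-elim : ∀ {j p} {F : Fin (suc j) → Set p} → (∀ u → F (inject₁ u)) → F (fromℕ j) → ∀ v → F v
inject₁-fromℕ-elim {zero}          old new zero    = new
inject₁-fromℕ-elim {suc j}         old new zero    = old zero
inject₁-fromℕ-elim {suc j} {F = F} old new (suc v) = inject₁-fromℕ-elim {F = F ∘ suc} (old ∘ suc) new v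

mapLit-∘ : ∀ {A B D : Set} (f : B → D) (g : A → B) → mapLit f ∘ mapLit g ≗ mapLit (f ∘ g)
mapLit-∘ f g (pos v) = ≡.refl
mapLit-∘ f g (neg v) = ≡.refl

mapLit-id : ∀ {A : Set} → mapLit {A} (λ v → v) ≗ (λ l → l)
mapLit-id (pos v) = ≡.refl
mapLit-id (neg v) = ≡.refl

mapCNF-∘ : ∀ {A B D : Set} (f : B → D) (g : A → B) → mapCNF f ∘ mapCNF g ≗ mapCNF (f ∘ g)
mapCNF-∘ f g cs = ≡.trans (≡.sym (List.map-∘ cs))
  (List.map-cong (λ c → ≡.trans (≡.sym (List.map-∘ c)) (List.map-cong (mapLit-∘ f g) c)) cs)

mapCNF-id : ∀ {A : Set} → mapCNF {A} (λ v → v) ≗ (λ cs → cs)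
mapCNF-id cs = ≡.trans (List.map-cong (λ c → ≡.trans (List.map-cong mapLit-id c) (List.map-id c)) cs) (List.map-id cs)

mapCNF-++-∘ : ∀ {A B D : Set} (f : B → D) (g : A → B) (cs : CNF A) (ds : CNF B) (es : CNF D)
            → mapCNF f (mapCNF g cs ++ ds) ++ es ≡ mapCNF (f ∘ g) cs ++ (mapCNF f ds ++ es)
mapCNF-++-∘ f g cs ds es = begin
  mapCNF f (mapCNF g cs ++ ds) ++ es              ≡⟨ ≡.cong (_++ es) (List.map-++ _ (mapCNF g cs) ds) ⟩
  (mapCNF f (mapCNF g cs) ++ mapCNF f ds) ++ es   ≡⟨ List.++-assoc (mapCNF f (mapCNF g cs)) _ _ ⟩
  mapCNF f (mapCNF g cs) ++ (mapCNF f ds ++ es)   ≡⟨ ≡.cong (_++ _) (mapCNF-∘ f g cs) ⟩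
  mapCNF (f ∘ g) cs ++ (mapCNF f ds ++ es)        ∎
  where open ≡.≡-Reasoning

-- The ring solver needs coefficients with a decidable equality; ℤ maps into every commutative ring.
module IntegerCoefficients {c ℓ} (S : CommutativeRing c ℓ) where
  open CommutativeRing S
  open import Algebra.Properties.Ring ring using (-0#≈0#; -‿involutive; -‿+-comm; -‿distribˡ-*; -‿distribʳ-*)
  open import Algebra.Properties.CommutativeSemigroup +-commutativeSemigroup using (interchange)
  open import Algebra.Properties.Semiring.Mult.TCOptimised semiring
    using (1+×; ×-homo-+; ×1-homo-*) renaming (_×_ to _×′_)
  open import Relation.Binary.Reasoning.Setoid setoid

  signed : Sign → Carrier → Carrier
  signed Sign.+ x = x
  signed Sign.- x = - x

  fromℤ : ℤ → Carrier
  fromℤ i = signed (sign i) (∣ i ∣ ×′ 1#)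

  signed-cong : ∀ s {x y} → x ≈ y → signed s x ≈ signed s y
  signed-cong Sign.+ x≈y = x≈y
  signed-cong Sign.- x≈y = -‿cong x≈y

  signed-* : ∀ s t x y → signed (s Sign.* t) (x * y) ≈ signed s x * signed t y
  signed-* Sign.+ Sign.+ x y = refl
  signed-* Sign.+ Sign.- x y = -‿distribʳ-* x y
  signed-* Sign.- Sign.+ x y = -‿distribˡ-* x y
  signed-* Sign.- Sign.- x y = begin
    x * y         ≈⟨ -‿involutive (x * y) ⟨
    - - (x * y)   ≈⟨ -‿cong (-‿distribˡ-* x y) ⟩
    - (- x * y)   ≈⟨ -‿distribʳ-* (- x) y ⟩
    - x * - y     ∎

  fromℤ-◃ : ∀ s n → fromℤ (s ◃ n) ≈ signed s (n ×′ 1#)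
  fromℤ-◃ Sign.+ zero    = refl
  fromℤ-◃ Sign.- zero    = sym -0#≈0#
  fromℤ-◃ Sign.+ (suc n) = refl
  fromℤ-◃ Sign.- (suc n) = refl

  fromℤ-⊖ : ∀ m n → fromℤ (m ℤ.⊖ n) ≈ m ×′ 1# - n ×′ 1#
  fromℤ-⊖ zero    zero    = sym (-‿inverseʳ 0#)
  fromℤ-⊖ (suc m) zero    = sym (trans (+-congˡ -0#≈0#) (+-identityʳ _))
  fromℤ-⊖ zero    (suc n) = sym (+-identityˡ _)
  fromℤ-⊖ (suc m) (suc n) rewrite ℤ.[1+m]⊖[1+n]≡m⊖n m n = begin
    fromℤ (m ℤ.⊖ n)                        ≈⟨ fromℤ-⊖ m n ⟩
    m ×′ 1# - n ×′ 1#                      ≈⟨ +-identityˡ _ ⟨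
    0# + (m ×′ 1# - n ×′ 1#)               ≈⟨ +-congʳ (-‿inverseʳ 1#) ⟨
    (1# - 1#) + (m ×′ 1# - n ×′ 1#)        ≈⟨ interchange 1# (m ×′ 1#) (- 1#) (- (n ×′ 1#)) ⟨
    (1# + m ×′ 1#) + (- 1# - n ×′ 1#)      ≈⟨ +-congˡ (-‿+-comm 1# (n ×′ 1#)) ⟩
    (1# + m ×′ 1#) - (1# + n ×′ 1#)        ≈⟨ +-cong (1+× m 1#) (-‿cong (1+× n 1#)) ⟨
    suc m ×′ 1# - suc n ×′ 1#              ∎

  fromℤ-+ : ∀ i j → fromℤ (i ℤ.+ j) ≈ fromℤ i + fromℤ j
  fromℤ-+ (+ m)    (+ n)    = ×-homo-+ 1# m n
  fromℤ-+ (+ m)    -[1+ n ] = fromℤ-⊖ m (suc n)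
  fromℤ-+ -[1+ m ] (+ n)    = trans (fromℤ-⊖ n (suc m)) (+-comm _ _)
  fromℤ-+ -[1+ m ] -[1+ n ] = begin
    - (suc (suc (m ℕ.+ n)) ×′ 1#)   ≡⟨ ≡.cong (λ l → - (suc l ×′ 1#)) (ℕ.+-suc m n) ⟨
    - ((suc m ℕ.+ suc n) ×′ 1#)     ≈⟨ -‿cong (×-homo-+ 1# (suc m) (suc n)) ⟩
    - (suc m ×′ 1# + suc n ×′ 1#)   ≈⟨ -‿+-comm _ _ ⟨
    - (suc m ×′ 1#) - suc n ×′ 1#   ∎

  fromℤ-* : ∀ i j → fromℤ (i ℤ.* j) ≈ fromℤ i * fromℤ j
  fromℤ-* i j = begin
    fromℤ (s ◃ (∣ i ∣ ℕ.* ∣ j ∣))              ≈⟨ fromℤ-◃ s (∣ i ∣ ℕ.* ∣ j ∣) ⟩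
    signed s ((∣ i ∣ ℕ.* ∣ j ∣) ×′ 1#)         ≈⟨ signed-cong s (×1-homo-* ∣ i ∣ ∣ j ∣) ⟩
    signed s ((∣ i ∣ ×′ 1#) * (∣ j ∣ ×′ 1#))   ≈⟨ signed-* (sign i) (sign j) _ _ ⟩
    fromℤ i * fromℤ j                          ∎
    where s = sign i Sign.* sign j

  fromℤ-‿ : ∀ i → fromℤ (ℤ.- i) ≈ - fromℤ i
  fromℤ-‿ (+ zero)  = sym -0#≈0#
  fromℤ-‿ (+ suc n) = refl
  fromℤ-‿ -[1+ n ]  = sym (-‿involutive _)

  ℤ⟶ : ℤ.+-*-rawRing -Raw-AlmostCommutative⟶ fromCommutativeRing S
  ℤ⟶ = record
    { ⟦_⟧ = fromℤ ; +-homo = fromℤ-+ ; *-homo = fromℤ-* ; -‿homo = fromℤ-‿ ; 0-homo = refl ; 1-homo = refl }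

  fromℤ-≟ : ∀ i j → Maybe (fromℤ i ≈ fromℤ j)
  fromℤ-≟ i j with i ℤ.≟ j
  ... | yes ≡.refl = just refl
  ... | no _       = nothing

  open import Algebra.Solver.Ring ℤ.+-*-rawRing (fromCommutativeRing S) ℤ⟶ fromℤ-≟ public

subst-cong : ∀ {a ℓ} (R : CommutativeRing a ℓ) {V W : Set} {σ τ : W → Term R V} → σ ≗ τ → subst R σ ≗ subst R τ
subst-cong R σ≗τ (var w) = σ≗τ w
subst-cong R σ≗τ (con r) = ≡.refl
subst-cong R σ≗τ (p ⊕ q) = ≡.cong₂ _⊕_ (subst-cong R σ≗τ p) (subst-cong R σ≗τ q)
subst-cong R σ≗τ (p ⊗ q) = ≡.cong₂ _⊗_ (subst-cong R σ≗τ p) (subst-cong R σ≗τ q)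

module Polynomials {a ℓ} (R : CommutativeRing a ℓ) (V : Set) where
  private module R = CommutativeRing R

  ⊕-⊗-isCommutativeRing : IsCommutativeRing (_≋_ R {V}) _⊕_ _⊗_ (con (R.- R.1#) ⊗_) (con R.0#) (con R.1#)
  ⊕-⊗-isCommutativeRing = record
    { isRing = record
      { +-isAbelianGroup = record
        { isGroup = record
          { isMonoid = record
            { isSemigroup = record
              { isMagma = record
                { isEquivalence = record { refl = ≋-refl ; sym = ≋-sym ; trans = ≋-trans }
                ; ∙-cong = ⊕-cong }
              ; assoc = ⊕-assoc }
            ; identity = ⊕-idˡ , λ p → ≋-trans (⊕-comm p _) (⊕-idˡ p) }
          ; inverse = ⊕-invˡ , λ p → ≋-trans (⊕-comm p _) (⊕-invˡ p)
          ; ⁻¹-cong = ⊗-cong ≋-refl }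
        ; comm = ⊕-comm }
      ; *-cong = ⊗-cong
      ; *-assoc = ⊗-assoc
      ; *-identity = ⊗-idˡ , λ p → ≋-trans (⊗-comm p _) (⊗-idˡ p)
      ; distrib = distribˡ , λ p q r →
          ≋-trans (⊗-comm _ p) (≋-trans (distribˡ p q r) (⊕-cong (⊗-comm p q) (⊗-comm p r))) }
    ; *-comm = ⊗-comm }

  polynomialRing : CommutativeRing a (a ⊔ ℓ)
  polynomialRing = record { isCommutativeRing = ⊕-⊗-isCommutativeRing }

  open CommutativeRing polynomialRing public
    using (_≈_; _+_; _*_; -_; _-_; 0#; 1#; sym; +-identityˡ; -‿inverseʳ; *-comm; zeroˡ; zeroʳ)

module PolynomialIdentities {a ℓ} (R : CommutativeRing a ℓ) (V : Set) where
  open Polynomials R V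
  open IntegerCoefficients polynomialRing using (solve; _:=_; _:+_; _:*_; _:-_; :-_; Polynomial; con)

  private
    𝟙 : ∀ {m} → Polynomial m
    𝟙 = con (+ 1)

  1-idempotent : 0# ≈ 1# - 1# * 1#
  1-idempotent = solve 0 (con (+ 0) := 𝟙 :- 𝟙 :* 𝟙) ≋-refl

  complement-idempotent : ∀ x → (1# - x) - (1# - x) * (1# - x) ≈ - (x * x - x)
  complement-idempotent = solve 1 (λ x → (𝟙 :- x) :- (𝟙 :- x) :* (𝟙 :- x) := :- (x :* x :- x)) ≋-refl

  double-complement-idempotent : ∀ x → (1# - (1# - x)) - (1# - (1# - x)) * (1# - (1# - x)) ≈ - (x * x - x)
  double-complement-idempotent =
    solve 1 (λ x → (𝟙 :- (𝟙 :- x)) :- (𝟙 :- (𝟙 :- x)) :* (𝟙 :- (𝟙 :- x)) := :- (x :* x :- x)) ≋-refl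

  idempotent-* : ∀ a b → (a - a * a) * b + a * a * (b - b * b) ≈ a * b - a * b * (a * b)
  idempotent-* = solve 2 (λ a b → (a :- a :* a) :* b :+ a :* a :* (b :- b :* b) := a :* b :- a :* b :* (a :* b)) ≋-refl

  peel-clause : ∀ p S → (1# - (1# - p) * S) * p + S * (p - p * p) ≈ p
  peel-clause = solve 2 (λ p S → (𝟙 :- (𝟙 :- p) :* S) :* p :+ S :* (p :- p :* p) := p) ≋-refl

  peel-rest : ∀ p S → (1# - (1# - p) * S) - S * p ≈ 1# - S
  peel-rest = solve 2 (λ p S → (𝟙 :- (𝟙 :- p) :* S) :- S :* p := 𝟙 :- S) ≋-refl

  ¬-gate-equation : ∀ g h T →
    prodNeg R (neg g ∷ neg h ∷ []) - prodNeg R (pos g ∷ pos h ∷ []) - (var h - T) ≈ var g - (1# - T)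
  ¬-gate-equation g h = solve 3 (λ G A T →
    (𝟙 :- (𝟙 :- G)) :* ((𝟙 :- (𝟙 :- A)) :* 𝟙) :- (𝟙 :- G) :* ((𝟙 :- A) :* 𝟙) :- (A :- T)
    := G :- (𝟙 :- T)) ≋-refl (var g) (var h)

  ∧-gate-equation : ∀ g h h′ Tₕ Tₕ′ →
    prodNeg R (neg g ∷ pos h ∷ []) + prodNeg R (neg g ∷ pos h′ ∷ []) * var h - prodNeg R (pos g ∷ neg h ∷ neg h′ ∷ [])
      + (var h′ - Tₕ′) * var h + (var h - Tₕ) * Tₕ′
    ≈ var g - Tₕ * Tₕ′
  ∧-gate-equation g h h′ = solve 5 (λ G A B Ta Tb →
    (𝟙 :- (𝟙 :- G)) :* ((𝟙 :- A) :* 𝟙) :+ (𝟙 :- (𝟙 :- G)) :* ((𝟙 :- B) :* 𝟙) :* A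
      :- (𝟙 :- G) :* ((𝟙 :- (𝟙 :- A)) :* ((𝟙 :- (𝟙 :- B)) :* 𝟙))
      :+ (B :- Tb) :* A :+ (A :- Ta) :* Tb
    := G :- Ta :* Tb) ≋-refl (var g) (var h) (var h′)

  ∨-gate-equation : ∀ g h h′ Tₕ Tₕ′ →
    prodNeg R (neg g ∷ pos h ∷ pos h′ ∷ []) - prodNeg R (pos g ∷ neg h′ ∷ [])
      - prodNeg R (pos g ∷ neg h ∷ []) * (1# - var h′) + (var h′ - Tₕ′) * (1# - var h) + (var h - Tₕ) * (1# - Tₕ′)
    ≈ var g - (1# - (1# - Tₕ) * (1# - Tₕ′))
  ∨-gate-equation g h h′ = solve 5 (λ G A B Ta Tb →
    (𝟙 :- (𝟙 :- G)) :* ((𝟙 :- A) :* ((𝟙 :- B) :* 𝟙)) :- (𝟙 :- G) :* ((𝟙 :- (𝟙 :- B)) :* 𝟙)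
      :- (𝟙 :- G) :* ((𝟙 :- (𝟙 :- A)) :* 𝟙) :* (𝟙 :- B) :+ (B :- Tb) :* (𝟙 :- A) :+ (A :- Ta) :* (𝟙 :- Tb)
    := G :- (𝟙 :- (𝟙 :- Ta) :* (𝟙 :- Tb))) ≋-refl (var g) (var h) (var h′)

  output-equation : ∀ o T → 1# - algCNF R ((pos o ∷ []) ∷ []) + (var o - T) ≈ 1# - T
  output-equation o = solve 2 (λ X T → 𝟙 :- (𝟙 :- (𝟙 :- X) :* 𝟙) :* 𝟙 :+ (X :- T) := 𝟙 :- T) ≋-refl (var o)

module Construction {a ℓ} (R : CommutativeRing a ℓ) (W : Set) where

  Program : ℕ → Set a
  Program = AGates R W

  value : ∀ {s} → Program s → Fin s → Term R W
  value P = lookup (agatesVals R P)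

  infix 4 _⊑_
  data _⊑_ {s} (P : Program s) : ∀ {t} → Program t → Set a where
    ⊑-refl : P ⊑ P
    ⊑-step : ∀ {t} {Q : Program t} {g} → P ⊑ Q → P ⊑ Q ▷ g

  ⊑-trans : ∀ {s t u} {P : Program s} {Q : Program t} {S : Program u} → P ⊑ Q → Q ⊑ S → P ⊑ S
  ⊑-trans P⊑Q ⊑-refl       = P⊑Q
  ⊑-trans P⊑Q (⊑-step Q⊑S) = ⊑-step (⊑-trans P⊑Q Q⊑S)

  weakenIndex : ∀ {s t} {P : Program s} {Q : Program t} → P ⊑ Q → Fin s → Fin t
  weakenIndex ⊑-refl       i = i
  weakenIndex (⊑-step P⊑Q) i = inject₁ (weakenIndex P⊑Q i)

  value-weakenIndex : ∀ {s t} {P : Program s} {Q : Program t} (P⊑Q : P ⊑ Q) i → value Q (weakenIndex P⊑Q i) ≡ value P i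
  value-weakenIndex ⊑-refl i = ≡.refl
  value-weakenIndex {Q = Q ▷ g} (⊑-step P⊑Q) i =
    ≡.trans (lookup-∷ʳ-inject₁ (agatesVals R Q) _ (weakenIndex P⊑Q i)) (value-weakenIndex P⊑Q i)

  Monotone : ∀ {p} → (∀ {t} → Program t → Set p) → Set (a ⊔ p)
  Monotone X = ∀ {t u} {Q : Program t} {S : Program u} → Q ⊑ S → X Q → X S

  record Build {s} (P : Program s) (K : ℕ) {p} (X : ∀ {t} → Program t → Set p) : Set (a ⊔ p) where
    constructor build
    field
      {size}  : ℕ
      program : Program size
      extends : P ⊑ program
      bounded : size ≤ K ℕ.+ s
      result  : X program

  module _ {s} {P : Program s} {p} {X : ∀ {t} → Program t → Set p} where

    return : X P → Build P 0 X
    return x = build P ⊑-refl ℕ.≤-refl x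

    relax : ∀ {K K′} → K ≤ K′ → Build P K X → Build P K′ X
    relax K≤K′ (build Q P⊑Q Q≤ x) = build Q P⊑Q (ℕ.≤-trans Q≤ (ℕ.+-monoˡ-≤ s K≤K′)) x

    _<$>_ : ∀ {K q} {Y : ∀ {t} → Program t → Set q} → (∀ {t} {Q : Program t} → X Q → Y Q) → Build P K X → Build P K Y
    f <$> build Q P⊑Q Q≤ x = build Q P⊑Q Q≤ (f x)

    _>>=_ : ∀ {K K′ q} {Y : ∀ {t} → Program t → Set q}
          → Build P K X → (∀ {t} {Q : Program t} → P ⊑ Q × X Q → Build Q K′ Y) → Build P (K′ ℕ.+ K) Y
    _>>=_ {K} {K′} (build {u} Q P⊑Q Q≤ x) continue with continue (P⊑Q , x)
    ... | build {v} S Q⊑S S≤ y = build S (⊑-trans P⊑Q Q⊑S) bound y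
      where
      open ℕ.≤-Reasoning
      bound : v ≤ K′ ℕ.+ K ℕ.+ s
      bound = begin
        v                  ≤⟨ S≤ ⟩
        K′ ℕ.+ u           ≤⟨ ℕ.+-monoʳ-≤ K′ Q≤ ⟩
        K′ ℕ.+ (K ℕ.+ s)   ≡⟨ ℕ.+-assoc K′ K s ⟨
        K′ ℕ.+ K ℕ.+ s     ∎

  gate : ∀ {s} {P : Program s} (g : AGate R W s) → Build P 1 (λ {t} Q → Σ (Fin t) λ i → value Q i ≡ agateVal R (agatesVals R P) g)
  gate {s} {P} g = build (P ▷ g) (⊑-step ⊑-refl) ℕ.≤-refl (fromℕ s , lookup-∷ʳ-fromℕ (agatesVals R P) _)

-- A node represents the pair of polynomials obtained by substituting σ₁ and σ₀ for the wires.
-- With σ₁ plugging in the hypotheses and σ₀ zeros, a node representing (A , 0) is an IPS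
-- derivation of A.
module Certificates {a ℓ} (R : CommutativeRing a ℓ) {V W : Set} (σ₁ σ₀ : W → Term R V) where
  open Construction R W
  open Polynomials R V using (_≈_; _+_; _*_; _-_; 0#; +-identityˡ; zeroˡ; zeroʳ)
  private module R = CommutativeRing R

  record Node {s} (P : Program s) (A B : Term R V) : Set (a ⊔ ℓ) where
    constructor node
    field
      index : Fin s
      eval₁ : subst R σ₁ (value P index) ≈ A
      eval₀ : subst R σ₀ (value P index) ≈ B
  open Node public

  Derives : ∀ {s} → Program s → Term R V → Set (a ⊔ ℓ)
  Derives P A = Node P A 0#

  Computes : ∀ {s} → Program s → Term R V → Set (a ⊔ ℓ)
  Computes P p = Node P p p

  castNode : ∀ {s} {P : Program s} {A A′ B B′} → A ≈ A′ → B ≈ B′ → Node P A B → Node P A′ B′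
  castNode A≈A′ B≈B′ (node i e₁ e₀) = node i (≋-trans e₁ A≈A′) (≋-trans e₀ B≈B′)

  weakenNode : ∀ {A B} → Monotone (λ P → Node P A B)
  weakenNode {Q = Q} {S} Q⊑S (node i e₁ e₀) = node (weakenIndex Q⊑S i) (≋-trans (same σ₁) e₁) (≋-trans (same σ₀) e₀)
    where
    same : ∀ σ → subst R σ (value S (weakenIndex Q⊑S i)) ≈ subst R σ (value Q i)
    same σ rewrite value-weakenIndex Q⊑S i = ≋-refl

  gateNode : ∀ {s} {P : Program s} {A B} (g : AGate R W s)
           → subst R σ₁ (agateVal R (agatesVals R P) g) ≈ A → subst R σ₀ (agateVal R (agatesVals R P) g) ≈ B
           → Build P 1 (λ Q → Node Q A B)
  gateNode g e₁ e₀ = (λ (i , eq) → node i (≋-trans (subst-≡ eq σ₁) e₁) (≋-trans (subst-≡ eq σ₀) e₀)) <$> gate g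
    where
    subst-≡ : ∀ {t u} → t ≡ u → ∀ σ → subst R σ t ≈ subst R σ u
    subst-≡ ≡.refl σ = ≋-refl

  -- The index counts the gates emitted; nodes already in the program are free. All costs below
  -- are exact, so operands that are nodes are kept on the left, where they leave no stuck n + 0.
  infixl 6 _+ₑ_
  infixl 7 _*ₑ_
  data Expr {s} (P : Program s) : Term R V → Term R V → ℕ → Set (a ⊔ ℓ) where
    ⟨_⟩   : ∀ {A B} → Node P A B → Expr P A B 0
    input : (w : W) → Expr P (σ₁ w) (σ₀ w) 1
    const : (r : R.Carrier) → Expr P (con r) (con r) 1
    _+ₑ_  : ∀ {A B C D m n} → Expr P A B m → Expr P C D n → Expr P (A ⊕ C) (B ⊕ D) (1 ℕ.+ m ℕ.+ n)
    _*ₑ_  : ∀ {A B C D m n} → Expr P A B m → Expr P C D n → Expr P (A ⊗ C) (B ⊗ D) (1 ℕ.+ m ℕ.+ n)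
    cast  : ∀ {A A′ B B′ n} → A ≈ A′ → B ≈ B′ → Expr P A B n → Expr P A′ B′ n

  emitAt : ∀ {s t} {P : Program s} {Q : Program t} {A B n} → P ⊑ Q → Expr P A B n → Build Q n (λ S → Node S A B)
  emitAt P⊑Q ⟨ x ⟩        = return (weakenNode P⊑Q x)
  emitAt P⊑Q (input w)    = gateNode (aVar w) ≋-refl ≋-refl
  emitAt P⊑Q (const r)    = gateNode (aCon r) ≋-refl ≋-refl
  emitAt P⊑Q (e +ₑ f)     = do
    (Q⊑S , y) ← emitAt P⊑Q f
    (S⊑T , x) ← emitAt (⊑-trans P⊑Q Q⊑S) e
    let y′ = weakenNode S⊑T y
    gateNode (aAdd (index x) (index y′)) (⊕-cong (eval₁ x) (eval₁ y′)) (⊕-cong (eval₀ x) (eval₀ y′))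
  emitAt P⊑Q (e *ₑ f)     = do
    (Q⊑S , y) ← emitAt P⊑Q f
    (S⊑T , x) ← emitAt (⊑-trans P⊑Q Q⊑S) e
    let y′ = weakenNode S⊑T y
    gateNode (aMul (index x) (index y′)) (⊗-cong (eval₁ x) (eval₁ y′)) (⊗-cong (eval₀ x) (eval₀ y′))
  emitAt P⊑Q (cast p q e) = castNode p q <$> emitAt P⊑Q e

  emit : ∀ {s} {P : Program s} {A B n} → Expr P A B n → Build P n (λ Q → Node Q A B)
  emit = emitAt ⊑-refl

  Derivation : ∀ {s} → Program s → Term R V → ℕ → Set (a ⊔ ℓ)
  Derivation P A = Expr P A 0#

  Computation : ∀ {s} → Program s → Term R V → ℕ → Set (a ⊔ ℓ)
  Computation P p = Expr P p p

  module _ {s} {P : Program s} where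

    infixl 6 _-ₑ_ _⊹_ _⊟_
    infixl 7 _·_ _·ʳ_

    _-ₑ_ : ∀ {A B C D m n} → Expr P A B m → Expr P C D n → Expr P (A - C) (B - D) (1 ℕ.+ m ℕ.+ (2 ℕ.+ n))
    e -ₑ f = e +ₑ const (R.- R.1#) *ₑ f

    _⊹_ : ∀ {A C m n} → Derivation P A m → Derivation P C n → Derivation P (A + C) (1 ℕ.+ m ℕ.+ n)
    d ⊹ e = cast ≋-refl (+-identityˡ 0#) (d +ₑ e)

    _·_ : ∀ {p A m n} → Computation P p m → Derivation P A n → Derivation P (p * A) (1 ℕ.+ m ℕ.+ n)
    e · d = cast ≋-refl (zeroʳ _) (e *ₑ d)

    _·ʳ_ : ∀ {A p m n} → Derivation P A m → Computation P p n → Derivation P (A * p) (1 ℕ.+ m ℕ.+ n)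
    d ·ʳ e = cast ≋-refl (zeroˡ _) (d *ₑ e)

    _⊟_ : ∀ {A C m n} → Derivation P A m → Derivation P C n → Derivation P (A - C) (1 ℕ.+ m ℕ.+ (2 ℕ.+ n))
    d ⊟ e = d ⊹ const (R.- R.1#) · e

    by : ∀ {A A′ n} → A ≈ A′ → Derivation P A n → Derivation P A′ n
    by A≈A′ = cast A≈A′ ≋-refl

gateBudget : ℕ
gateBudget = 500

module CircuitCertificate {a ℓ} (R : CommutativeRing a ℓ) {n k : ℕ} (C : BoolCircuit n k) where
  private module R = CommutativeRing R
  open Polynomials R (Fin k)
  open PolynomialIdentities R (Fin k)

  -- inj₁ v is the variable x_v of r₁(C), inj₂ j the placeholder y_j of the hypothesis hyps R C j.
  Wire : Set
  Wire = Fin k ⊎ Fin (suc k)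

  withHypotheses : Wire → Term R (Fin k)
  withHypotheses (inj₁ v) = var v
  withHypotheses (inj₂ j) = hyps R C j

  withZeros : Wire → Term R (Fin k)
  withZeros (inj₁ v) = var v
  withZeros (inj₂ j) = 0#

  open Construction R Wire
  open Certificates R withHypotheses withZeros

  termSize : Term R (Fin k) → ℕ
  termSize (var v) = 1
  termSize (con r) = 1
  termSize (p ⊕ q) = 1 ℕ.+ termSize p ℕ.+ termSize q
  termSize (p ⊗ q) = 1 ℕ.+ termSize p ℕ.+ termSize q

  module _ {s} {P : Program s} where

    formula : (p : Term R (Fin k)) → Computation P p (termSize p)
    formula (var v) = input (inj₁ v)
    formula (con r) = const r
    formula (p ⊕ q) = formula p +ₑ formula q
    formula (p ⊗ q) = formula p *ₑ formula q

    hypothesis : Derivation P (1# - algCNF R (r₁ C)) 1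
    hypothesis = input (inj₂ zero)

    booleanAxiom : (v : Fin k) → Derivation P (var v * var v - var v) 1
    booleanAxiom v = input (inj₂ (suc v))

    complement-idempotence : (l : Literal (Fin k)) → let u = 1# - algLit R l in Derivation P (u - u * u) 3
    complement-idempotence (pos v) = by (sym (complement-idempotent (var v))) (const (R.- R.1#) · booleanAxiom v)
    complement-idempotence (neg v) = by (sym (double-complement-idempotent (var v))) (const (R.- R.1#) · booleanAxiom v)

  idempotenceCost : Clause (Fin k) → ℕ
  idempotenceCost []       = 1
  idempotenceCost (l ∷ ls) = 5 ℕ.+ termSize (prodNeg R ls) ℕ.+ (2 ℕ.+ u ℕ.+ u ℕ.+ idempotenceCost ls)
    where u = termSize (1# - algLit R l)

  prodNeg-idempotence : ∀ {s} {P : Program s} (c : Clause (Fin k)) → let p = prodNeg R c in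
                        Derivation P (p - p * p) (idempotenceCost c)
  prodNeg-idempotence []       = by 1-idempotent (const R.0#)
  prodNeg-idempotence (l ∷ ls) = by (idempotent-* _ _)
    (complement-idempotence l ·ʳ formula (prodNeg R ls) ⊹ formula u *ₑ formula u · prodNeg-idempotence ls)
    where u = 1# - algLit R l

  peelCost : Clause (Fin k) → ℕ
  peelCost c = 6 ℕ.+ termSize (prodNeg R c) ℕ.+ (1 ℕ.+ idempotenceCost c)

  peel : ∀ {s} {P : Program s} (c : Clause (Fin k)) {S} → Derives P (1# - algClause R c * S) → Computes P S
       → Build P (peelCost c) (λ Q → Derives Q (prodNeg R c) × Derives Q (1# - S))
  peel c H S = do
    (P⊑Q , F) ← emit (by (peel-clause p _) (⟨ H ⟩ ·ʳ formula p ⊹ ⟨ S ⟩ · prodNeg-idempotence c))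
    (Q⊑T , H′) ← emit (by (peel-rest p _) (⟨ weakenNode P⊑Q H ⟩ ⊟ ⟨ weakenNode P⊑Q S ⟩ · ⟨ F ⟩))
    return (weakenNode Q⊑T F , H′)
    where p = prodNeg R c

  clausesCost : CNF (Fin k) → ℕ
  clausesCost []       = 0
  clausesCost (c ∷ cs) = clausesCost cs ℕ.+ (peelCost c ℕ.+ (1 ℕ.+ termSize (algClause R c)))

  -- The nodes for algCNF (cs ++ rest) are emitted from the back of cs before the continuation
  -- runs; the clauses are peeled from the front of cs after it returns.
  peelClauses : ∀ {s} {P : Program s} (cs rest : CNF (Fin k)) {K p} {X : ∀ {t} → Program t → Set p} → Monotone X
              → Computes P (algCNF R rest)
              → (∀ {t} {Q : Program t} → P ⊑ Q → Computes Q (algCNF R (cs ++ rest))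
                   → Build Q K (λ S → X S × Derives S (1# - algCNF R (cs ++ rest))))
              → Build P (clausesCost cs ℕ.+ K)
                  (λ Q → (X Q × All (λ c → Derives Q (prodNeg R c)) cs) × Derives Q (1# - algCNF R rest))
  peelClauses [] rest weaken S continue = (λ (x , H) → (x , []) , H) <$> continue ⊑-refl S
  peelClauses (c ∷ cs) rest {K} {X = X} weaken S continue =
    relax (ℕ.≤-reflexive (shuffle (clausesCost cs) (peelCost c) K (1 ℕ.+ termSize (algClause R c))))
      ((λ (((x , F) , Fs) , H) → (x , F ∷ Fs) , H) <$>
        peelClauses cs rest {X = λ Q → X Q × Derives Q (prodNeg R c)} (λ e (x , F) → weaken e x , weakenNode e F) S
          λ P⊑Q S′ → do
            (Q⊑T , S″) ← emit (cast (*-comm _ _) (*-comm _ _) (⟨ S′ ⟩ *ₑ formula (algClause R c)))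
            (T⊑U , x , H) ← continue (⊑-trans P⊑Q Q⊑T) S″
            (U⊑V , F , H′) ← peel c H (weakenNode (⊑-trans Q⊑T T⊑U) S′)
            return ((weaken U⊑V x , F) , H′))
    where
    shuffle : ∀ a b K c → a ℕ.+ (b ℕ.+ K ℕ.+ c) ≡ a ℕ.+ (b ℕ.+ c) ℕ.+ K
    shuffle = solve-∀

  nodeValue : ∀ {j} → Gates n j → (Fin j → Fin k) → Fin j → Term R (Fin k)
  nodeValue gs ι v = rename R (λ i → ι (inputNode gs i)) (lookup (algNodes R gs) v)

  newNodeValue : ∀ {j} → Gates n j → Gate j → (Fin (suc j) → Fin k) → Term R (Fin k)
  newNodeValue gs g ι = rename R (λ i → ι (inject₁ (inputNode gs i))) (algGate R (algNodes R gs) g)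

  record Entry {s} (P : Program s) (x : Fin k) (T : Term R (Fin k)) : Set (a ⊔ ℓ) where
    constructor entry
    field
      computed : Computes P T
      defining : Derives P (var x - T)

  Table : ∀ {s j} → Program s → Gates n j → (Fin j → Fin k) → Set (a ⊔ ℓ)
  Table P gs ι = ∀ v → Entry P (ι v) (nodeValue gs ι v)

  weakenTable : ∀ {j} {gs : Gates n j} {ι} → Monotone (λ P → Table P gs ι)
  weakenTable P⊑Q table v = entry (weakenNode P⊑Q computed) (weakenNode P⊑Q defining)
    where open Entry (table v)

  extendTable : ∀ {s} {P : Program s} {j} (gs : Gates n j) (g : Gate j) (ι : Fin (suc j) → Fin k)
              → Table P gs (ι ∘ inject₁) → Entry P (ι (fromℕ j)) (newNodeValue gs g ι) → Table P (gs ▷ g) ι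
  extendTable {P = P} {j} gs g ι table new = inject₁-fromℕ-elim {F = λ v → Entry P (ι v) (nodeValue (gs ▷ g) ι v)}
    (λ u → ≡.subst (Entry P _) (≡.cong (rename R f) (≡.sym (lookup-∷ʳ-inject₁ (algNodes R gs) _ u))) (table u))
    (≡.subst (Entry P _) (≡.cong (rename R f) (≡.sym (lookup-∷ʳ-fromℕ (algNodes R gs) _))) new)
    where f = λ i → ι (inject₁ (inputNode gs i))

  gateEntry : ∀ {s} {P : Program s} {j} (gs : Gates n j) (g : Gate j) (ι : Fin (suc j) → Fin k)
            → Table P gs (ι ∘ inject₁) → All (λ c → Derives P (prodNeg R c)) (mapCNF ι (gateClauses g))
            → Build P 40 (λ Q → Entry Q (ι (fromℕ j)) (newNodeValue gs g ι))
  gateEntry gs (notG h) ι table (F₁ ∷ F₂ ∷ []) = relax (ℕ.≤ᵇ⇒≤ _ _ tt) do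
    (P⊑Q , T) ← emit (const R.1# -ₑ ⟨ Tₕ ⟩)
    (Q⊑S , E) ← emitAt P⊑Q (by (¬-gate-equation _ _ _) (⟨ F₂ ⟩ ⊟ ⟨ F₁ ⟩ ⊟ ⟨ Eₕ ⟩))
    return (entry (weakenNode Q⊑S T) E)
    where open Entry (table h) renaming (computed to Tₕ; defining to Eₕ)
  gateEntry gs (andG h h′) ι table (F₁ ∷ F₂ ∷ F₃ ∷ []) = relax (ℕ.≤ᵇ⇒≤ _ _ tt) do
    (P⊑Q , T) ← emit (⟨ Tₕ ⟩ *ₑ ⟨ Tₕ′ ⟩)
    (Q⊑S , E) ← emitAt P⊑Q (by (∧-gate-equation _ _ _ _ _)
      (⟨ F₁ ⟩ ⊹ ⟨ F₂ ⟩ ·ʳ formula (var _) ⊟ ⟨ F₃ ⟩ ⊹ ⟨ Eₕ′ ⟩ ·ʳ formula (var _) ⊹ ⟨ Eₕ ⟩ ·ʳ ⟨ Tₕ′ ⟩))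
    return (entry (weakenNode Q⊑S T) E)
    where
    open Entry (table h) renaming (computed to Tₕ; defining to Eₕ)
    open Entry (table h′) renaming (computed to Tₕ′; defining to Eₕ′)
  gateEntry gs (orG h h′) ι table (F₁ ∷ F₂ ∷ F₃ ∷ []) = relax (ℕ.≤ᵇ⇒≤ _ _ tt) do
    (P⊑Q , T) ← emit (const R.1# -ₑ (const R.1# -ₑ ⟨ Tₕ ⟩) *ₑ (const R.1# -ₑ ⟨ Tₕ′ ⟩))
    (Q⊑S , E) ← emitAt P⊑Q (by (∨-gate-equation _ _ _ _ _)
      (⟨ F₁ ⟩ ⊟ ⟨ F₃ ⟩ ⊟ ⟨ F₂ ⟩ ·ʳ formula (1# - var _) ⊹ ⟨ Eₕ′ ⟩ ·ʳ formula (1# - var _)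
         ⊹ ⟨ Eₕ ⟩ ·ʳ (const R.1# -ₑ ⟨ Tₕ′ ⟩)))
    return (entry (weakenNode Q⊑S T) E)
    where
    open Entry (table h) renaming (computed to Tₕ; defining to Eₕ)
    open Entry (table h′) renaming (computed to Tₕ′; defining to Eₕ′)

  -- For a fixed kind of gate the clauses have fixed shapes, so the costs are numerals.
  gate-fits : ∀ {j} (ι : Fin (suc j) → Fin k) g → 40 ℕ.+ clausesCost (mapCNF ι (gateClauses g)) ≤ gateBudget
  gate-fits ι (notG h)    = ℕ.≤ᵇ⇒≤ _ _ tt
  gate-fits ι (andG h h′) = ℕ.≤ᵇ⇒≤ _ _ tt
  gate-fits ι (orG h h′)  = ℕ.≤ᵇ⇒≤ _ _ tt

  emitVariables : ∀ {s} {P : Program s} {m} (f : Fin m → Fin k) → Build P m (λ Q → ∀ v → Computes Q (var (f v)))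
  emitVariables {m = zero}  f = return λ ()
  emitVariables {m = suc m} f = do
    (P⊑Q , xs) ← emitVariables (f ∘ suc)
    (Q⊑S , x) ← emit (formula (var (f zero)))
    return λ { zero → x ; (suc v) → weakenNode Q⊑S (xs v) }

  certifyGates : ∀ {s} {P : Program s} {j} (gs : Gates n j) (ι : Fin j → Fin k) (rest : CNF (Fin k))
               → mapCNF ι (bodyClauses gs) ++ rest ≡ r₁ C → Computes P (algCNF R rest)
               → Build P (2 ℕ.+ j ℕ.* gateBudget) (λ Q → Table Q gs ι × Derives Q (1# - algCNF R rest))
  certifyGates inputs ι rest ≡.refl S = relax (ℕ.+-monoʳ-≤ 2 (ℕ.m≤m*n n gateBudget)) do
    (P⊑Q , xs) ← emitVariables ι
    (Q⊑T , H) ← emit hypothesis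
    (T⊑U , Z) ← emit (const R.0#)
    return (inputTable (⊑-trans Q⊑T T⊑U) xs Z , weakenNode T⊑U H)
    where
    inputTable : ∀ {t u} {Q : Program t} {U : Program u}
               → Q ⊑ U → (∀ v → Computes Q (var (ι v))) → Derives U 0# → Table U inputs ι
    inputTable Q⊑U xs Z v = ≡.subst (Entry _ (ι v)) (≡.cong (rename R ι) (≡.sym (Vec.lookup∘tabulate var v)))
      (entry (weakenNode Q⊑U (xs v)) (castNode (sym (-‿inverseʳ _)) ≋-refl Z))
  certifyGates {j = suc j} (gs ▷ g) ι rest eq S = relax (step-fits 40 _ (j ℕ.* gateBudget) (gate-fits ι g)) do
    (P⊑Q , (table , Fs) , H) ← peelClauses (mapCNF ι (gateClauses g)) rest (weakenTable {gs = gs}) S λ _ S′ →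
      certifyGates gs (ι ∘ inject₁) _ (≡.trans (≡.sym (mapCNF-++-∘ ι inject₁ (bodyClauses gs) _ rest)) eq) S′
    (Q⊑T , new) ← gateEntry gs g ι table Fs
    return (extendTable gs g ι (weakenTable {gs = gs} Q⊑T table) new , weakenNode Q⊑T H)
    where
    step-fits : ∀ a b m → a ℕ.+ b ≤ gateBudget → a ℕ.+ (b ℕ.+ (2 ℕ.+ m)) ≤ 2 ℕ.+ (gateBudget ℕ.+ m)
    step-fits a b m a+b≤ = ℕ.≤-trans (ℕ.≤-reflexive (shuffle a b m)) (ℕ.+-monoʳ-≤ 2 (ℕ.+-monoˡ-≤ m a+b≤))
      where
      shuffle : ∀ a b m → a ℕ.+ (b ℕ.+ (2 ℕ.+ m)) ≡ 2 ℕ.+ (a ℕ.+ b ℕ.+ m)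
      shuffle = solve-∀

  outputClause : CNF (Fin k)
  outputClause = (pos (output C) ∷ []) ∷ []

  certificate : Build [] (3 ℕ.+ k ℕ.* gateBudget ℕ.+ 13) (λ P → Derives P (target R C))
  certificate = do
    (_ , S) ← emit (formula (algCNF R outputClause))
    (_ , table , H) ← certifyGates (body C) (λ v → v) outputClause (≡.cong (_++ outputClause) (mapCNF-id _)) S
    emit (by (output-equation _ _) (⟨ H ⟩ ⊹ ⟨ Entry.defining (table (output C)) ⟩))

  -- IPS substitutes through its own pattern-matching functions, equal to ours only pointwise.
  toIPS : ∀ {K} → Build [] K (λ P → Derives P (target R C))
        → Σ (IPS R (hyps R C) (target R C)) (λ d → ipsSize R d ≤ K)
  toIPS {K} (build P _ bounded (node i eval₁ eval₀)) =
    record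
      { proof  = algCircuit _ P i
      ; sound  = ≡.subst (_≈ target R C) (subst-cong R (λ { (inj₁ v) → ≡.refl ; (inj₂ j) → ≡.refl }) (value P i)) eval₁
      ; vanish = ≡.subst (_≈ 0#) (subst-cong R (λ { (inj₁ v) → ≡.refl ; (inj₂ j) → ≡.refl }) (value P i)) eval₀
      }
    , ≡.subst (_ ≤_) (ℕ.+-identityʳ K) bounded

certificate-size : ∀ K k → 3 ℕ.+ suc k ℕ.* K ℕ.+ 13 ≤ (K ℕ.+ 16) ℕ.* suc k
certificate-size K k = begin
  3 ℕ.+ suc k ℕ.* K ℕ.+ 13        ≡⟨ shuffle K k ⟩
  K ℕ.+ 16 ℕ.+ k ℕ.* K            ≤⟨ ℕ.+-monoʳ-≤ (K ℕ.+ 16) (ℕ.*-monoʳ-≤ k (ℕ.m≤m+n K 16)) ⟩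
  K ℕ.+ 16 ℕ.+ k ℕ.* (K ℕ.+ 16)   ≡⟨ ℕ.*-comm (K ℕ.+ 16) (suc k) ⟨
  (K ℕ.+ 16) ℕ.* suc k            ∎
  where
  open ℕ.≤-Reasoning
  shuffle : ∀ K k → 3 ℕ.+ suc k ℕ.* K ℕ.+ 13 ≡ K ℕ.+ 16 ℕ.+ k ℕ.* K
  shuffle = solve-∀

open import Data.Nat using (_*_)

lemma2p5 : ∃Const (λ c → ∀ {a ℓ} (R : CommutativeRing a ℓ) {n k : ℕ} (C : BoolCircuit n k)
             → Σ (IPS R (hyps R C) (target R C)) (λ d → ipsSize R d ≤ c * gates C))
lemma2p5 = gateBudget ℕ.+ 16 , λ where
  R {k = zero}  (circuit _ ())
  R {k = suc k} C → let open CircuitCertificate R C in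
    map₂ (λ size≤ → ℕ.≤-trans size≤ (certificate-size gateBudget k)) (toIPS certificate)
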